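{- Let $p$ be a prime. Suppose $A, B \subset \mathbb{Z}/p\mathbb{Z}$ have densities $\gamma$ and $\delta$ respectively, i.e. $|A| = \gamma p$ and $|B| = \delta p$. Suppose moreover that $A$ contains $\alpha\gamma^3 p^2$ non-trivial 3AP's and $B$ contains $\beta\delta^3 p^2$ non-trivial 3AP's. Then there exists a subset $C \subseteq \mathbb{Z}/p\mathbb{Z}$ of density at least $\gamma\delta + O(p^{ -1/4})$ such that the number of non-trivial 3AP's lying in $C$ is at most $$\alpha\beta(\gamma\delta)^3 p^2 + O(p^{3/2}).$$
   Context: A three-term arithmetic progression (3AP) in $\mathbb{Z}/p\mathbb{Z}$ is an ordered triple of residues $n, n+m, n+2m$ modulo $p$. It is non-trivial if $m \not\equiv 0 \pmod p$. Progressions are counted as ordered triples, so $n,n+m,n+2m$ and $n+2m,n+m,n$ are counted separately. The density of a set $X \subseteq \mathbb{Z}/p\mathbb{Z}$ is $|X|/p$. The implied constants in the $O(\cdot)$ terms may depend on $\gamma$ and $\delta$. -}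

module Defs where

open import Data.Nat using (ℕ; zero; suc; _+_; _*_; NonZero)
open import Data.Nat.DivMod using (_mod_)
open import Data.Fin using (Fin; toℕ)
open import Data.Fin.Subset using (Subset)
open import Data.Bool using (Bool; true; false; _∧_; if_then_else_; not)
open import Data.Vec using (lookup)
open import Data.List using (List; map; allFin)
open import Data.Nat.ListAction using (sum)

_+ₚ_ : {p : ℕ} .{{_ : NonZero p}} → Fin p → Fin p → Fin p
_+ₚ_ {p} a b = (toℕ a + toℕ b) mod p

isZero : {p : ℕ} → Fin p → Bool
isZero m with toℕ m
... | zero = true
... | suc _ = false

is3AP : {p : ℕ} .{{_ : NonZero p}} → Subset p → Fin p → Fin p → Bool
is3AP X n m =
  not (isZero m) ∧ lookup X n ∧ lookup X (n +ₚ m) ∧ lookup X ((n +ₚ m) +ₚ m)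

-- Number of non-trivial 3APs in X, counted as ordered triples,
-- i.e. the number of pairs (n , m) with m ≢ 0 and n, n+m, n+2m ∈ X.
num3AP : {p : ℕ} .{{_ : NonZero p}} → Subset p → ℕ
num3AP {p} X =
  sum (map (λ n → sum (map (λ m → if is3AP X n m then 1 else 0) (allFin p))) (allFin p))

-- For l, μ ∈ ℤ/pℤ put C l μ = A ∩ φ⁻¹(B) with φ x = l x + μ, and average over all p² pairs
-- (l, μ).  Since (φ x, φ y) runs over (ℤ/pℤ)² exactly once when x ≠ y, |C| has mean |A||B|/p and
-- variance at most |A||B|/p.  A non-trivial 3AP (n, n + m, n + 2m) of C is a 3AP of A whose image
-- (φ n, φ n + l m, φ n + 2 l m) is a progression in B, trivial only for l = 0; hence the mean number
-- of 3APs of C is at most N(A)(N(B) + p)/p².  A pair (l, μ) at or below the average of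
-- r N(C) + (|A||B| − p|C|)², with r ≈ p^(3/2), controls both errors at once.

module Submission where

open import Defs
open import Algebra.Bundles using (CommutativeMonoid)
open import Data.Bool using (Bool; true; false; if_then_else_; not; _∧_)
open import Data.Bool.Properties using (∧-assoc; ∧-commutativeMonoid)
open import Algebra.Properties.CommutativeSemigroup (CommutativeMonoid.commutativeSemigroup ∧-commutativeMonoid) using (interchange)
open import Data.Fin using (Fin; zero; suc; toℕ; punchIn; punchOut)
open import Data.Fin.Permutation using (Permutation; permutation)
open import Data.Fin.Properties using (any?; toℕ-fromℕ<; toℕ-injective; toℕ<n; punchOut-injective; punchInᵢ≢i; injective⇒≤) renaming (_≟_ to _≟ᶠ_)
open import Data.Fin.Subset using (Subset; ∣_∣; _∩_)
open import Data.Fin.Subset.Properties using (∣p∣≤n)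
open import Data.List using (map; allFin; tabulate)
open import Data.List.Properties using (map-tabulate)
open import Data.Nat using (ℕ; zero; suc; _+_; _*_; _∸_; _^_; _≤_; _<_; _≥_; NonZero; >-nonZero⁻¹; z≤n; s≤s)
open import Data.Nat.DivMod using (_%_; _/_; _mod_; m%n%n≡m%n; %-distribˡ-+; %-distribˡ-*; [m+n]%n≡m%n; m<n⇒m%n≡m; m≡m%n+[m/n]*n)
open import Data.Nat.Divisibility using (_∣_; divides; n∣m⇒m%n≡0)
open import Data.Nat.ListAction using () renaming (sum to sumₗ)
open import Data.Nat.Primality using (Prime; euclidsLemma)
open import Data.Nat.Properties
open import Data.Nat.Solver using (module +-*-Solver)
open +-*-Solver using (solve; _:+_; _:*_; _:^_; _:=_; con)
open import Data.Product using (∃-syntax; _×_; _,_; proj₁; proj₂)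
open import Data.Sum using (inj₁; inj₂; [_,_]′)
open import Data.Vec using ([]; _∷_; lookup) renaming (tabulate to tabulateᵥ)
open import Data.Vec.Properties using (lookup-zipWith; lookup∘tabulate)
open import Function using (_∘_)
open import Function.Definitions using (Injective; StrictlySurjective)
open import Relation.Nullary using (yes; no; contradiction)
open import Relation.Binary.PropositionalEquality
open import Algebra.Properties.Semiring.Sum +-*-semiring using (sum; sum-syntax; sum-cong-≗; ∑-distrib-+; ∑-comm; *-distribˡ-sum; *-distribʳ-sum; ∑-permute; sum-remove)

-- Finite sums

𝟙 : Bool → ℕ
𝟙 b = if b then 1 else 0

𝟙≤1 : ∀ b → 𝟙 b ≤ 1
𝟙≤1 true = ≤-refl
𝟙≤1 false = z≤n

𝟙-∧ : ∀ b c → 𝟙 (b ∧ c) ≡ 𝟙 b * 𝟙 c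
𝟙-∧ true c = sym (+-identityʳ (𝟙 c))
𝟙-∧ false c = refl

𝟙-idem : ∀ b → 𝟙 b * 𝟙 b ≡ 𝟙 b
𝟙-idem true = refl
𝟙-idem false = refl

𝟙*-≤ : ∀ b x → 𝟙 b * x ≤ x
𝟙*-≤ true x = ≤-reflexive (*-identityˡ x)
𝟙*-≤ false x = z≤n

𝟙-*-mono-≤ : ∀ b {x y} → (b ≡ true → x ≤ y) → 𝟙 b * x ≤ 𝟙 b * y
𝟙-*-mono-≤ true x≤y = *-monoʳ-≤ 1 (x≤y refl)
𝟙-*-mono-≤ false x≤y = z≤n

𝟙≤𝟙[not-z∧b]+𝟙z : ∀ z b → 𝟙 b ≤ 𝟙 (not z ∧ b) + 𝟙 z
𝟙≤𝟙[not-z∧b]+𝟙z true b = 𝟙≤1 b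
𝟙≤𝟙[not-z∧b]+𝟙z false b = m≤m+n (𝟙 b) 0

∑-const : ∀ n c → ∑[ i < n ] c ≡ n * c
∑-const zero c = refl
∑-const (suc n) c = cong (c +_) (∑-const n c)

∑-mono-≤ : ∀ {n} {f g : Fin n → ℕ} → (∀ i → f i ≤ g i) → sum f ≤ sum g
∑-mono-≤ {zero} f≤g = z≤n
∑-mono-≤ {suc n} f≤g = +-mono-≤ (f≤g zero) (∑-mono-≤ (f≤g ∘ suc))

sumₗ-tabulate : ∀ {n} (f : Fin n → ℕ) → sumₗ (tabulate f) ≡ sum f
sumₗ-tabulate {zero} f = refl
sumₗ-tabulate {suc n} f = cong (f zero +_) (sumₗ-tabulate (f ∘ suc))

sumₗ-map-allFin : ∀ {n} (f : Fin n → ℕ) → sumₗ (map f (allFin n)) ≡ sum f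
sumₗ-map-allFin f = trans (cong sumₗ (map-tabulate (λ i → i) f)) (sumₗ-tabulate f)

injective⇒surjective : ∀ {n} {f : Fin n → Fin n} → Injective _≡_ _≡_ f → StrictlySurjective _≡_ f
injective⇒surjective {suc n} {f} f-inj y with any? (λ x → f x ≟ᶠ y)
... | yes hit = hit
... | no miss = contradiction (injective⇒≤ avoid-y-injective) 1+n≰n
  where
  y≢f : ∀ x → y ≢ f x
  y≢f x y≡fx = miss (x , sym y≡fx)
  avoid-y : Fin (suc n) → Fin n
  avoid-y x = punchOut (y≢f x)
  avoid-y-injective : Injective _≡_ _≡_ avoid-y
  avoid-y-injective = f-inj ∘ punchOut-injective (y≢f _) (y≢f _)

injective⇒permutation : ∀ {n} {f : Fin n → Fin n} → Injective _≡_ _≡_ f → Permutation n n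
injective⇒permutation {f = f} f-inj =
  permutation f (proj₁ ∘ surj) (proj₂ ∘ surj) (λ x → f-inj (proj₂ (surj (f x))))
  where surj = injective⇒surjective f-inj

∑-injective : ∀ {n} {h : Fin n → Fin n} → Injective _≡_ _≡_ h → (f : Fin n → ℕ) → ∑[ i < n ] f (h i) ≡ sum f
∑-injective h-inj f = sym (∑-permute f (injective⇒permutation h-inj))

∑-remove-≤ : ∀ {n} {f g : Fin n → ℕ} i → (∀ j → j ≢ i → f j ≤ g j) → sum f ≤ f i + sum g
∑-remove-≤ {suc n} {f} {g} i f≤g = begin
  sum f                              ≡⟨ sum-remove f ⟩
  f i + sum (f ∘ punchIn i)          ≤⟨ +-monoʳ-≤ (f i) (∑-mono-≤ (λ j → f≤g (punchIn i j) (punchInᵢ≢i i j))) ⟩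
  f i + sum (g ∘ punchIn i)          ≤⟨ +-monoʳ-≤ (f i) (m≤n+m _ (g i)) ⟩
  f i + (g i + sum (g ∘ punchIn i))  ≡⟨ cong (f i +_) (sum-remove g) ⟨
  f i + sum g                        ∎
  where open ≤-Reasoning

∑-comm₃ : ∀ {m n o} (f : Fin m → Fin n → Fin o → ℕ) →
          ∑[ i < m ] ∑[ j < n ] ∑[ k < o ] f i j k ≡ ∑[ k < o ] ∑[ i < m ] ∑[ j < n ] f i j k
∑-comm₃ f = trans (sum-cong-≗ (λ i → ∑-comm (f i))) (∑-comm (λ i k → ∑[ j < _ ] f i j k))

∑∑-cong : ∀ {m n} {F G : Fin m → Fin n → ℕ} → (∀ i j → F i j ≡ G i j) →
          ∑[ i < m ] ∑[ j < n ] F i j ≡ ∑[ i < m ] ∑[ j < n ] G i j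
∑∑-cong F≡G = sum-cong-≗ (λ i → sum-cong-≗ (F≡G i))

∑∑-mono-≤ : ∀ {m n} {F G : Fin m → Fin n → ℕ} → (∀ i j → F i j ≤ G i j) →
            ∑[ i < m ] ∑[ j < n ] F i j ≤ ∑[ i < m ] ∑[ j < n ] G i j
∑∑-mono-≤ F≤G = ∑-mono-≤ (λ i → ∑-mono-≤ (F≤G i))

∑∑-distrib-+ : ∀ {m n} (F G : Fin m → Fin n → ℕ) →
               ∑[ i < m ] ∑[ j < n ] (F i j + G i j) ≡ (∑[ i < m ] ∑[ j < n ] F i j) + (∑[ i < m ] ∑[ j < n ] G i j)
∑∑-distrib-+ F G = trans (sum-cong-≗ (λ i → ∑-distrib-+ (F i) (G i))) (∑-distrib-+ (sum ∘ F) (sum ∘ G))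

*-distribˡ-∑∑ : ∀ {m n} c (F : Fin m → Fin n → ℕ) →
                c * (∑[ i < m ] ∑[ j < n ] F i j) ≡ ∑[ i < m ] ∑[ j < n ] (c * F i j)
*-distribˡ-∑∑ c F = trans (*-distribˡ-sum c (sum ∘ F)) (sum-cong-≗ (λ i → *-distribˡ-sum c (F i)))

∑∑-const : ∀ m n c → ∑[ i < m ] ∑[ j < n ] c ≡ m * (n * c)
∑∑-const m n c = trans (sum-cong-≗ {m} (λ _ → ∑-const n c)) (∑-const m (n * c))

*-distribʳ-∑∑ : ∀ {m n} c (F : Fin m → Fin n → ℕ) →
                (∑[ i < m ] ∑[ j < n ] F i j) * c ≡ ∑[ i < m ] ∑[ j < n ] (F i j * c)
*-distribʳ-∑∑ c F = trans (*-distribʳ-sum c (sum ∘ F)) (sum-cong-≗ (λ i → *-distribʳ-sum c (F i)))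

∑∑-comm-∑∑ : ∀ {m n o q} (F : Fin m → Fin n → Fin o → Fin q → ℕ) →
             ∑[ i < m ] ∑[ j < n ] ∑[ k < o ] ∑[ l < q ] F i j k l ≡ ∑[ k < o ] ∑[ l < q ] ∑[ i < m ] ∑[ j < n ] F i j k l
∑∑-comm-∑∑ F = trans (∑-comm₃ (λ i j k → sum (F i j k))) (sum-cong-≗ (λ k → ∑-comm₃ (λ i j → F i j k)))

sum-*-sum : ∀ {m n} (f : Fin m → ℕ) (g : Fin n → ℕ) → sum f * sum g ≡ ∑[ i < m ] ∑[ j < n ] (f i * g j)
sum-*-sum f g = trans (*-distribʳ-sum (sum g) f) (sum-cong-≗ (λ i → *-distribˡ-sum (f i) g))

argmin : ∀ {n} (f : Fin (suc n) → ℕ) → ∃[ i ] (∀ j → f i ≤ f j)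
argmin {zero} f = zero , λ { zero → ≤-refl }
argmin {suc n} f with argmin (f ∘ suc)
... | i , fi≤ with f zero ≤? f (suc i)
...   | yes f0≤fi = zero , λ { zero → ≤-refl ; (suc j) → ≤-trans f0≤fi (fi≤ j) }
...   | no f0≰fi = suc i , λ { zero → <⇒≤ (≰⇒> f0≰fi) ; (suc j) → fi≤ j }

∃-≤-average : ∀ {n} .{{_ : NonZero n}} (f : Fin n → ℕ) → ∃[ i ] (n * f i ≤ sum f)
∃-≤-average {suc n} f with argmin f
... | i , fi≤ = i , ≤-trans (≤-reflexive (sym (∑-const (suc n) (f i)))) (∑-mono-≤ fi≤)

∃∃-≤-average : ∀ {m n} .{{_ : NonZero m}} .{{_ : NonZero n}} (F : Fin m → Fin n → ℕ) →
               ∃[ i ] ∃[ j ] (m * (n * F i j) ≤ ∑[ i < m ] ∑[ j < n ] F i j)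
∃∃-≤-average {m} F with ∃-≤-average (λ i → sum (F i))
... | i , avg-i with ∃-≤-average (F i)
...   | j , avg-j = i , j , ≤-trans (*-monoʳ-≤ m avg-j) avg-i

-- Elementary inequalities

∸-square : ∀ {m n} → n ≤ m → (m ∸ n) ^ 2 + 2 * m * n ≡ m ^ 2 + n ^ 2
∸-square {m} {n} n≤m = begin
  (m ∸ n) ^ 2 + 2 * m * n             ≡⟨ cong (λ k → (m ∸ n) ^ 2 + 2 * k * n) (m+[n∸m]≡n n≤m) ⟨
  (m ∸ n) ^ 2 + 2 * (n + (m ∸ n)) * n ≡⟨ expand n (m ∸ n) ⟩
  (n + (m ∸ n)) ^ 2 + n ^ 2           ≡⟨ cong (λ k → k ^ 2 + n ^ 2) (m+[n∸m]≡n n≤m) ⟩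
  m ^ 2 + n ^ 2                       ∎
  where
  open ≡-Reasoning
  expand : ∀ n k → k ^ 2 + 2 * (n + k) * n ≡ (n + k) ^ 2 + n ^ 2
  expand = solve 2 (λ n k → k :^ 2 :+ con 2 :* (n :+ k) :* n := (n :+ k) :^ 2 :+ n :^ 2) refl

2mn≤m²+n² : ∀ m n → 2 * m * n ≤ m ^ 2 + n ^ 2
2mn≤m²+n² m n with ≤-total n m
... | inj₁ n≤m = ≤-trans (m≤n+m (2 * m * n) _) (≤-reflexive (∸-square n≤m))
... | inj₂ m≤n = begin
  2 * m * n               ≡⟨ *-comm-after-2 ⟩
  2 * n * m               ≤⟨ m≤n+m (2 * n * m) _ ⟩
  (n ∸ m) ^ 2 + 2 * n * m ≡⟨ ∸-square m≤n ⟩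
  n ^ 2 + m ^ 2           ≡⟨ +-comm (n ^ 2) (m ^ 2) ⟩
  m ^ 2 + n ^ 2           ∎
  where
  open ≤-Reasoning
  *-comm-after-2 : 2 * m * n ≡ 2 * n * m
  *-comm-after-2 = trans (*-assoc 2 m n) (trans (cong (2 *_) (*-comm m n)) (sym (*-assoc 2 n m)))

[m∸n]²+2mn≤m²+n² : ∀ m n → (m ∸ n) ^ 2 + 2 * m * n ≤ m ^ 2 + n ^ 2
[m∸n]²+2mn≤m²+n² m n with ≤-total n m
... | inj₁ n≤m = ≤-reflexive (∸-square n≤m)
... | inj₂ m≤n = subst (λ k → k ^ 2 + 2 * m * n ≤ m ^ 2 + n ^ 2) (sym (m≤n⇒m∸n≡0 m≤n)) (2mn≤m²+n² m n)

[m+n]²≤2[m²+n²] : ∀ m n → (m + n) ^ 2 ≤ 2 * (m ^ 2 + n ^ 2)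
[m+n]²≤2[m²+n²] m n = begin
  (m + n) ^ 2                      ≡⟨ expand m n ⟩
  m ^ 2 + n ^ 2 + 2 * m * n        ≤⟨ +-monoʳ-≤ (m ^ 2 + n ^ 2) (2mn≤m²+n² m n) ⟩
  m ^ 2 + n ^ 2 + (m ^ 2 + n ^ 2)  ≡⟨ cong (m ^ 2 + n ^ 2 +_) (+-identityʳ (m ^ 2 + n ^ 2)) ⟨
  2 * (m ^ 2 + n ^ 2)              ∎
  where
  open ≤-Reasoning
  expand : ∀ m n → (m + n) ^ 2 ≡ m ^ 2 + n ^ 2 + 2 * m * n
  expand = solve 2 (λ m n → (m :+ n) :^ 2 := m :^ 2 :+ n :^ 2 :+ con 2 :* m :* n) refl

floor-sqrt : ∀ n → ∃[ r ] (r ^ 2 ≤ n × n < suc r ^ 2)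
floor-sqrt zero = 0 , z≤n , s≤s z≤n
floor-sqrt (suc n) with floor-sqrt n
... | r , r²≤n , n<[1+r]² with suc r ^ 2 ≤? suc n
...   | yes [1+r]²≤1+n = suc r , [1+r]²≤1+n , ≤-<-trans n<[1+r]² (^-monoˡ-< 2 (n<1+n (suc r)))
...   | no [1+r]²≰1+n = r , ≤-trans r²≤n (n≤1+n n) , ≰⇒> [1+r]²≰1+n

coarse-sqrt : ∀ n .{{_ : NonZero n}} → ∃[ r ] (r ^ 2 ≤ n × n ≤ 4 * r ^ 2)
coarse-sqrt n with floor-sqrt n
... | zero , _ , n<1 = contradiction n<1 (≤⇒≯ (>-nonZero⁻¹ n))
... | suc k , [1+k]²≤n , n<[2+k]² = suc k , [1+k]²≤n , (begin
  n                        ≤⟨ <⇒≤ n<[2+k]² ⟩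
  (2 + k) ^ 2              ≤⟨ m≤m+n _ (k * (3 * k + 4)) ⟩
  (2 + k) ^ 2 + k * (3 * k + 4) ≡⟨ expand k ⟨
  4 * (1 + k) ^ 2          ∎)
  where
  open ≤-Reasoning
  expand : ∀ k → 4 * (1 + k) ^ 2 ≡ (2 + k) ^ 2 + k * (3 * k + 4)
  expand = solve 1 (λ k → con 4 :* (con 1 :+ k) :^ 2 := (con 2 :+ k) :^ 2 :+ k :* (con 3 :* k :+ con 4)) refl

∑∑-[c∸X]²-≤ : ∀ {m n} c (X : Fin m → Fin n → ℕ) →
              (∑[ i < m ] ∑[ j < n ] ((c ∸ X i j) ^ 2)) + 2 * c * (∑[ i < m ] ∑[ j < n ] X i j)
                ≤ m * (n * c ^ 2) + ∑[ i < m ] ∑[ j < n ] (X i j ^ 2)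
∑∑-[c∸X]²-≤ {m} {n} c X = begin
  (∑[ i < m ] ∑[ j < n ] ((c ∸ X i j) ^ 2)) + 2 * c * (∑[ i < m ] ∑[ j < n ] X i j)
    ≡⟨ cong ((∑[ i < m ] ∑[ j < n ] ((c ∸ X i j) ^ 2)) +_) (*-distribˡ-∑∑ (2 * c) X) ⟩
  (∑[ i < m ] ∑[ j < n ] ((c ∸ X i j) ^ 2)) + (∑[ i < m ] ∑[ j < n ] (2 * c * X i j))
    ≡⟨ ∑∑-distrib-+ (λ i j → (c ∸ X i j) ^ 2) (λ i j → 2 * c * X i j) ⟨
  ∑[ i < m ] ∑[ j < n ] ((c ∸ X i j) ^ 2 + 2 * c * X i j)
    ≤⟨ ∑∑-mono-≤ (λ i j → [m∸n]²+2mn≤m²+n² c (X i j)) ⟩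
  ∑[ i < m ] ∑[ j < n ] (c ^ 2 + X i j ^ 2)
    ≡⟨ ∑∑-distrib-+ (λ _ _ → c ^ 2) (λ i j → X i j ^ 2) ⟩
  (∑[ i < m ] ∑[ j < n ] (c ^ 2)) + (∑[ i < m ] ∑[ j < n ] (X i j ^ 2))
    ≡⟨ cong (_+ (∑[ i < m ] ∑[ j < n ] (X i j ^ 2))) (∑∑-const m n (c ^ 2)) ⟩
  m * (n * c ^ 2) + ∑[ i < m ] ∑[ j < n ] (X i j ^ 2)
    ∎
  where open ≤-Reasoning

-- Arithmetic in ℤ/pℤ

∣<⇒≡0 : ∀ {n k} .{{_ : NonZero n}} → n ∣ k → k < n → k ≡ 0
∣<⇒≡0 {n} {k} n∣k k<n = trans (sym (m<n⇒m%n≡m k<n)) (n∣m⇒m%n≡0 k n n∣k)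

module _ {p : ℕ} .{{_ : NonZero p}} where

  infix 4 _≡ₚ_
  _≡ₚ_ : ℕ → ℕ → Set
  a ≡ₚ b = a % p ≡ b % p

  _*ₚ_ : Fin p → Fin p → Fin p
  a *ₚ b = (toℕ a * toℕ b) mod p

  _−ₚ_ : Fin p → Fin p → Fin p
  a −ₚ b = (toℕ a + (p ∸ toℕ b)) mod p

  affine : Fin p → Fin p → Fin p → Fin p
  affine l μ x = (l *ₚ x) +ₚ μ

  %-≡ₚ : ∀ a → a % p ≡ₚ a
  %-≡ₚ a = m%n%n≡m%n a p

  +-congₚ : ∀ {a a′ b b′} → a ≡ₚ a′ → b ≡ₚ b′ → a + b ≡ₚ a′ + b′
  +-congₚ {a} {a′} {b} {b′} a≡a′ b≡b′ = begin
    (a + b) % p ≡⟨ %-distribˡ-+ a b p ⟩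
    (a % p + b % p) % p ≡⟨ cong₂ (λ x y → (x + y) % p) a≡a′ b≡b′ ⟩
    (a′ % p + b′ % p) % p ≡⟨ %-distribˡ-+ a′ b′ p ⟨
    (a′ + b′) % p ∎
    where open ≡-Reasoning

  *-congₚ : ∀ {a a′ b b′} → a ≡ₚ a′ → b ≡ₚ b′ → a * b ≡ₚ a′ * b′
  *-congₚ {a} {a′} {b} {b′} a≡a′ b≡b′ = begin
    (a * b) % p ≡⟨ %-distribˡ-* a b p ⟩
    (a % p * (b % p)) % p ≡⟨ cong₂ (λ x y → (x * y) % p) a≡a′ b≡b′ ⟩
    (a′ % p * (b′ % p)) % p ≡⟨ %-distribˡ-* a′ b′ p ⟨
    (a′ * b′) % p ∎
    where open ≡-Reasoning

  toℕ-mod : ∀ a → toℕ (a mod p) ≡ₚ a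
  toℕ-mod a = trans (cong (_% p) (toℕ-fromℕ< _)) (%-≡ₚ a)

  toℕ-+ₚ : ∀ u v → toℕ (u +ₚ v) ≡ₚ toℕ u + toℕ v
  toℕ-+ₚ u v = toℕ-mod (toℕ u + toℕ v)

  toℕ-*ₚ : ∀ u v → toℕ (u *ₚ v) ≡ₚ toℕ u * toℕ v
  toℕ-*ₚ u v = toℕ-mod (toℕ u * toℕ v)

  toℕ-affine : ∀ l μ x → toℕ (affine l μ x) ≡ₚ toℕ l * toℕ x + toℕ μ
  toℕ-affine l μ x = trans (toℕ-+ₚ (l *ₚ x) μ) (+-congₚ (toℕ-*ₚ l x) refl)

  toℕ-injectiveₚ : ∀ {u v : Fin p} → toℕ u ≡ₚ toℕ v → u ≡ v
  toℕ-injectiveₚ {u} {v} u≡v = toℕ-injective (begin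
    toℕ u ≡⟨ m<n⇒m%n≡m (toℕ<n u) ⟨
    toℕ u % p ≡⟨ u≡v ⟩
    toℕ v % p ≡⟨ m<n⇒m%n≡m (toℕ<n v) ⟩
    toℕ v ∎)
    where open ≡-Reasoning

  affine-+ₚ : ∀ l μ x y → affine l μ (x +ₚ y) ≡ affine l μ x +ₚ (l *ₚ y)
  affine-+ₚ l μ x y = toℕ-injectiveₚ (begin
    toℕ (affine l μ (x +ₚ y)) % p ≡⟨ toℕ-affine l μ (x +ₚ y) ⟩
    (l′ * toℕ (x +ₚ y) + μ′) % p ≡⟨ +-congₚ (*-congₚ {l′} refl (toℕ-+ₚ x y)) refl ⟩
    (l′ * (x′ + y′) + μ′) % p ≡⟨ cong (_% p) (distribute l′ x′ y′ μ′) ⟩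
    ((l′ * x′ + μ′) + l′ * y′) % p ≡⟨ +-congₚ (toℕ-affine l μ x) (toℕ-*ₚ l y) ⟨
    (toℕ (affine l μ x) + toℕ (l *ₚ y)) % p ≡⟨ toℕ-+ₚ (affine l μ x) (l *ₚ y) ⟨
    toℕ (affine l μ x +ₚ (l *ₚ y)) % p ∎)
    where
    open ≡-Reasoning
    l′ = toℕ l ; μ′ = toℕ μ ; x′ = toℕ x ; y′ = toℕ y
    distribute : ∀ l x y μ → l * (x + y) + μ ≡ (l * x + μ) + l * y
    distribute = solve 4 (λ l x y μ → l :* (x :+ y) :+ μ := (l :* x :+ μ) :+ l :* y) refl

  +ₚ-−ₚ : ∀ x y → x +ₚ (y −ₚ x) ≡ y
  +ₚ-−ₚ x y = toℕ-injectiveₚ (begin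
    toℕ (x +ₚ (y −ₚ x)) % p ≡⟨ toℕ-+ₚ x (y −ₚ x) ⟩
    (x′ + toℕ (y −ₚ x)) % p ≡⟨ +-congₚ {x′} refl (toℕ-mod (y′ + (p ∸ x′))) ⟩
    (x′ + (y′ + (p ∸ x′))) % p ≡⟨ cong (_% p) (rearrange x′ y′ (p ∸ x′)) ⟩
    (y′ + ((p ∸ x′) + x′)) % p ≡⟨ cong (λ z → (y′ + z) % p) (m∸n+n≡m (<⇒≤ (toℕ<n x))) ⟩
    (y′ + p) % p ≡⟨ [m+n]%n≡m%n y′ p ⟩
    y′ % p ∎)
    where
    open ≡-Reasoning
    x′ = toℕ x ; y′ = toℕ y
    rearrange : ∀ x y z → x + (y + z) ≡ y + (z + x)
    rearrange = solve 3 (λ x y z → x :+ (y :+ z) := y :+ (z :+ x)) refl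

  +ₚ-identityʳ : ∀ x {d} → toℕ d ≡ 0 → x +ₚ d ≡ x
  +ₚ-identityʳ x {d} d≡0 = toℕ-injectiveₚ (begin
    toℕ (x +ₚ d) % p ≡⟨ toℕ-+ₚ x d ⟩
    (toℕ x + toℕ d) % p ≡⟨ cong (λ z → (toℕ x + z) % p) d≡0 ⟩
    (toℕ x + 0) % p ≡⟨ cong (_% p) (+-identityʳ (toℕ x)) ⟩
    toℕ x % p ∎)
    where open ≡-Reasoning

  −ₚ≢0 : ∀ {x y} → x ≢ y → toℕ (y −ₚ x) ≢ 0
  −ₚ≢0 {x} {y} x≢y y−x≡0 = x≢y (trans (sym (+ₚ-identityʳ x y−x≡0)) (+ₚ-−ₚ x y))

  ≡ₚ⇒∣∸ : ∀ {a b} → a ≤ b → a ≡ₚ b → p ∣ b ∸ a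
  ≡ₚ⇒∣∸ {a} {b} a≤b a≡b = divides (b / p ∸ a / p) (begin
    b ∸ a ≡⟨ cong₂ _∸_ (m≡m%n+[m/n]*n b p) (m≡m%n+[m/n]*n a p) ⟩
    (b % p + b / p * p) ∸ (a % p + a / p * p) ≡⟨ cong (λ z → (b % p + b / p * p) ∸ (z + a / p * p)) a≡b ⟩
    (b % p + b / p * p) ∸ (b % p + a / p * p) ≡⟨ [m+n]∸[m+o]≡n∸o (b % p) _ _ ⟩
    b / p * p ∸ a / p * p ≡⟨ *-distribʳ-∸ p (b / p) (a / p) ⟨
    (b / p ∸ a / p) * p ∎)
    where open ≡-Reasoning

  ∣∸⇒≡ : ∀ {u v : Fin p} → toℕ u ≤ toℕ v → p ∣ toℕ v ∸ toℕ u → u ≡ v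
  ∣∸⇒≡ {u} {v} u≤v p∣v∸u =
    toℕ-injective (≤-antisym u≤v (m∸n≡0⇒m≤n (∣<⇒≡0 p∣v∸u (≤-<-trans (m∸n≤m (toℕ v) (toℕ u)) (toℕ<n v)))))

  injectiveₚ : {f : Fin p → Fin p} → (∀ {u v} → toℕ u ≤ toℕ v → f u ≡ f v → p ∣ toℕ v ∸ toℕ u) → Injective _≡_ _≡_ f
  injectiveₚ {f} divides-gap {u} {v} fu≡fv with ≤-total (toℕ u) (toℕ v)
  ... | inj₁ u≤v = ∣∸⇒≡ u≤v (divides-gap u≤v fu≡fv)
  ... | inj₂ v≤u = sym (∣∸⇒≡ v≤u (divides-gap v≤u (sym fu≡fv)))

  toℕ-cong-≡ₚ : ∀ {u v : Fin p} → u ≡ v → toℕ u ≡ₚ toℕ v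
  toℕ-cong-≡ₚ u≡v = cong (λ w → toℕ w % p) u≡v

  +ₚ-injectiveʳ : ∀ c → Injective _≡_ _≡_ (c +ₚ_)
  +ₚ-injectiveʳ c = injectiveₚ λ {u} {v} u≤v c+u≡c+v →
    subst (p ∣_) ([m+n]∸[m+o]≡n∸o (toℕ c) (toℕ v) (toℕ u))
      (≡ₚ⇒∣∸ (+-monoʳ-≤ (toℕ c) u≤v) (trans (sym (toℕ-+ₚ c u)) (trans (toℕ-cong-≡ₚ c+u≡c+v) (toℕ-+ₚ c v))))

  *ₚ-injectiveˡ : Prime p → ∀ {d} → toℕ d ≢ 0 → Injective _≡_ _≡_ (_*ₚ d)
  *ₚ-injectiveˡ p-prime {d} d≢0 = injectiveₚ λ {u} {v} u≤v ud≡vd →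
    [ (λ p∣v∸u → p∣v∸u) , (λ p∣d → contradiction (∣<⇒≡0 p∣d (toℕ<n d)) d≢0) ]′
      (euclidsLemma (toℕ v ∸ toℕ u) (toℕ d) p-prime
        (subst (p ∣_) (sym (*-distribʳ-∸ (toℕ d) (toℕ v) (toℕ u)))
          (≡ₚ⇒∣∸ (*-monoˡ-≤ (toℕ d) u≤v) (trans (sym (toℕ-*ₚ u d)) (trans (toℕ-cong-≡ₚ ud≡vd) (toℕ-*ₚ v d))))))

  ∑-translate : ∀ c (f : Fin p → ℕ) → ∑[ μ < p ] f (c +ₚ μ) ≡ sum f
  ∑-translate c = ∑-injective (+ₚ-injectiveʳ c)

  ∑-dilate : Prime p → ∀ {d} → toℕ d ≢ 0 → (f : Fin p → ℕ) → ∑[ l < p ] f (l *ₚ d) ≡ sum f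
  ∑-dilate p-prime d≢0 = ∑-injective (*ₚ-injectiveˡ p-prime d≢0)

isZero-≡0 : ∀ {n} {m : Fin n} → toℕ m ≡ 0 → isZero m ≡ true
isZero-≡0 {m = m} m≡0 with toℕ m | m≡0
... | zero | _ = refl
... | suc _ | ()

∑-isZero : ∀ {n} .{{_ : NonZero n}} → ∑[ v < n ] 𝟙 (isZero v) ≡ 1
∑-isZero {suc n} = cong suc (trans (∑-const n 0) (*-zeroʳ n))

-- Counting progressions

∣X∣≡∑𝟙 : ∀ {n} (X : Subset n) → ∣ X ∣ ≡ ∑[ x < n ] 𝟙 (lookup X x)
∣X∣≡∑𝟙 [] = refl
∣X∣≡∑𝟙 (true ∷ X) = cong suc (∣X∣≡∑𝟙 X)
∣X∣≡∑𝟙 (false ∷ X) = ∣X∣≡∑𝟙 X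

module _ {p : ℕ} .{{_ : NonZero p}} where

  AP : Subset p → Fin p → Fin p → Bool
  AP X n m = lookup X n ∧ lookup X (n +ₚ m) ∧ lookup X ((n +ₚ m) +ₚ m)

  num3AP≡∑∑ : ∀ X → num3AP X ≡ ∑[ n < p ] ∑[ m < p ] 𝟙 (is3AP X n m)
  num3AP≡∑∑ X = trans (sumₗ-map-allFin {p} _) (sum-cong-≗ {p} (λ n → sumₗ-map-allFin {p} _))

  num3AP≤p² : ∀ X → num3AP X ≤ p ^ 2
  num3AP≤p² X = begin
    num3AP X                                 ≡⟨ num3AP≡∑∑ X ⟩
    ∑[ n < p ] ∑[ m < p ] 𝟙 (is3AP X n m)    ≤⟨ ∑∑-mono-≤ (λ n m → 𝟙≤1 (is3AP X n m)) ⟩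
    ∑[ n < p ] ∑[ m < p ] 1                  ≡⟨ ∑∑-const p p 1 ⟩
    p ^ 2                                    ∎
    where open ≤-Reasoning

  is3AP⇒≢0 : ∀ X n m → is3AP X n m ≡ true → toℕ m ≢ 0
  is3AP⇒≢0 X n m is3AP≡true m≡0 with () ← trans (sym is3AP≡true) (cong (λ z → not z ∧ AP X n m) (isZero-≡0 m≡0))

  𝟙-AP≤ : ∀ X u v → 𝟙 (AP X u v) ≤ 𝟙 (is3AP X u v) + 𝟙 (isZero v)
  𝟙-AP≤ X u v = 𝟙≤𝟙[not-z∧b]+𝟙z (isZero v) (AP X u v)

  ∑∑-AP≤ : ∀ X → ∑[ u < p ] ∑[ v < p ] 𝟙 (AP X u v) ≤ num3AP X + p
  ∑∑-AP≤ X = begin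
    ∑[ u < p ] ∑[ v < p ] 𝟙 (AP X u v)                             ≤⟨ ∑∑-mono-≤ (𝟙-AP≤ X) ⟩
    ∑[ u < p ] ∑[ v < p ] (𝟙 (is3AP X u v) + 𝟙 (isZero v))        ≡⟨ ∑∑-distrib-+ (λ u v → 𝟙 (is3AP X u v)) (λ _ v → 𝟙 (isZero v)) ⟩
    (∑[ u < p ] ∑[ v < p ] 𝟙 (is3AP X u v)) + (∑[ u < p ] ∑[ v < p ] 𝟙 (isZero v))
      ≡⟨ cong₂ _+_ (sym (num3AP≡∑∑ X)) (trans (sum-cong-≗ {p} (λ _ → ∑-isZero)) (trans (∑-const p 1) (*-identityʳ p))) ⟩
    num3AP X + p                                                    ∎
    where open ≤-Reasoning

-- The intersection of A with an affine preimage of B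

preimage : ∀ {n} → (Fin n → Fin n) → Subset n → Subset n
preimage f X = tabulateᵥ (lookup X ∘ f)

∧-interchange₃ : ∀ a₁ b₁ a₂ b₂ a₃ b₃ →
                 (a₁ ∧ b₁) ∧ (a₂ ∧ b₂) ∧ (a₃ ∧ b₃) ≡ (a₁ ∧ a₂ ∧ a₃) ∧ (b₁ ∧ b₂ ∧ b₃)
∧-interchange₃ a₁ b₁ a₂ b₂ a₃ b₃ =
  trans (cong ((a₁ ∧ b₁) ∧_) (interchange a₂ b₂ a₃ b₃)) (interchange a₁ b₁ (a₂ ∧ a₃) (b₂ ∧ b₃))

module AffineIntersection {p : ℕ} .{{_ : NonZero p}} (p-prime : Prime p) (A B : Subset p) where

  C : Fin p → Fin p → Subset p
  C l μ = A ∩ preimage (affine l μ) B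

  𝟙A 𝟙B : Fin p → ℕ
  𝟙A x = 𝟙 (lookup A x)
  𝟙B y = 𝟙 (lookup B y)

  ∑𝟙A : sum 𝟙A ≡ ∣ A ∣
  ∑𝟙A = sym (∣X∣≡∑𝟙 A)

  ∑𝟙B : sum 𝟙B ≡ ∣ B ∣
  ∑𝟙B = sym (∣X∣≡∑𝟙 B)

  lookup-C : ∀ l μ x → lookup (C l μ) x ≡ lookup A x ∧ lookup B (affine l μ x)
  lookup-C l μ x = trans (lookup-zipWith _∧_ x A _) (cong (lookup A x ∧_) (lookup∘tabulate _ x))

  𝟙-C : ∀ l μ x → 𝟙 (lookup (C l μ) x) ≡ 𝟙A x * 𝟙B (affine l μ x)
  𝟙-C l μ x = trans (cong 𝟙 (lookup-C l μ x)) (𝟙-∧ (lookup A x) (lookup B (affine l μ x)))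

  AP-C : ∀ l μ n m → AP (C l μ) n m ≡ AP A n m ∧ AP B (affine l μ n) (l *ₚ m)
  AP-C l μ n m = begin
    AP (C l μ) n m
      ≡⟨ cong₂ _∧_ (lookup-C l μ n) (cong₂ _∧_ (lookup-C l μ n₁) (lookup-C l μ n₂)) ⟩
    (lookup A n ∧ lookup B (φ n)) ∧ (lookup A n₁ ∧ lookup B (φ n₁)) ∧ (lookup A n₂ ∧ lookup B (φ n₂))
      ≡⟨ ∧-interchange₃ (lookup A n) (lookup B (φ n)) (lookup A n₁) (lookup B (φ n₁)) (lookup A n₂) (lookup B (φ n₂)) ⟩
    AP A n m ∧ (lookup B (φ n) ∧ lookup B (φ n₁) ∧ lookup B (φ n₂))
      ≡⟨ cong₂ (λ u v → AP A n m ∧ (lookup B (φ n) ∧ lookup B u ∧ lookup B v))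
               φn₁≡ (trans (affine-+ₚ l μ n₁ m) (cong (_+ₚ (l *ₚ m)) φn₁≡)) ⟩
    AP A n m ∧ AP B (φ n) (l *ₚ m) ∎
    where
    open ≡-Reasoning
    φ = affine l μ
    n₁ = n +ₚ m
    n₂ = n₁ +ₚ m
    φn₁≡ : φ n₁ ≡ φ n +ₚ (l *ₚ m)
    φn₁≡ = affine-+ₚ l μ n m

  𝟙-is3AP-C : ∀ l μ n m → 𝟙 (is3AP (C l μ) n m) ≡ 𝟙 (is3AP A n m) * 𝟙 (AP B (affine l μ n) (l *ₚ m))
  𝟙-is3AP-C l μ n m = begin
    𝟙 (not (isZero m) ∧ AP (C l μ) n m)                       ≡⟨ cong (λ b → 𝟙 (not (isZero m) ∧ b)) (AP-C l μ n m) ⟩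
    𝟙 (not (isZero m) ∧ AP A n m ∧ AP B (affine l μ n) (l *ₚ m)) ≡⟨ cong 𝟙 (∧-assoc (not (isZero m)) _ _) ⟨
    𝟙 (is3AP A n m ∧ AP B (affine l μ n) (l *ₚ m))            ≡⟨ 𝟙-∧ (is3AP A n m) _ ⟩
    𝟙 (is3AP A n m) * 𝟙 (AP B (affine l μ n) (l *ₚ m))        ∎
    where open ≡-Reasoning

  ∑∑-𝟙B∘affine : ∀ x → ∑[ l < p ] ∑[ μ < p ] 𝟙B (affine l μ x) ≡ p * ∣ B ∣
  ∑∑-𝟙B∘affine x = begin
    ∑[ l < p ] ∑[ μ < p ] 𝟙B ((l *ₚ x) +ₚ μ) ≡⟨ sum-cong-≗ (λ l → trans (∑-translate (l *ₚ x) 𝟙B) ∑𝟙B) ⟩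
    ∑[ l < p ] ∣ B ∣                         ≡⟨ ∑-const p ∣ B ∣ ⟩
    p * ∣ B ∣                                ∎
    where open ≡-Reasoning

  ∑∑∣C∣ : ∑[ l < p ] ∑[ μ < p ] ∣ C l μ ∣ ≡ ∣ A ∣ * ∣ B ∣ * p
  ∑∑∣C∣ = begin
    ∑[ l < p ] ∑[ μ < p ] ∣ C l μ ∣
      ≡⟨ ∑∑-cong (λ l μ → trans (∣X∣≡∑𝟙 (C l μ)) (sum-cong-≗ (𝟙-C l μ))) ⟩
    ∑[ l < p ] ∑[ μ < p ] ∑[ x < p ] (𝟙A x * 𝟙B (affine l μ x))
      ≡⟨ ∑-comm₃ (λ l μ x → 𝟙A x * 𝟙B (affine l μ x)) ⟩
    ∑[ x < p ] ∑[ l < p ] ∑[ μ < p ] (𝟙A x * 𝟙B (affine l μ x))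
      ≡⟨ sum-cong-≗ (λ x → *-distribˡ-∑∑ (𝟙A x) (λ l μ → 𝟙B (affine l μ x))) ⟨
    ∑[ x < p ] (𝟙A x * ∑[ l < p ] ∑[ μ < p ] 𝟙B (affine l μ x))
      ≡⟨ sum-cong-≗ (λ x → cong (𝟙A x *_) (∑∑-𝟙B∘affine x)) ⟩
    ∑[ x < p ] (𝟙A x * (p * ∣ B ∣))
      ≡⟨ *-distribʳ-sum (p * ∣ B ∣) 𝟙A ⟨
    sum 𝟙A * (p * ∣ B ∣)
      ≡⟨ cong (_* (p * ∣ B ∣)) ∑𝟙A ⟩
    ∣ A ∣ * (p * ∣ B ∣)
      ≡⟨ cong (∣ A ∣ *_) (*-comm p ∣ B ∣) ⟩
    ∣ A ∣ * (∣ B ∣ * p)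
      ≡⟨ *-assoc ∣ A ∣ ∣ B ∣ p ⟨
    ∣ A ∣ * ∣ B ∣ * p
      ∎
    where open ≡-Reasoning

  Q : Fin p → Fin p → ℕ
  Q x y = ∑[ l < p ] ∑[ μ < p ] (𝟙B (affine l μ x) * 𝟙B (affine l μ y))

  Q-diagonal : ∀ x → Q x x ≡ p * ∣ B ∣
  Q-diagonal x = trans (∑∑-cong (λ l μ → 𝟙-idem (lookup B (affine l μ x)))) (∑∑-𝟙B∘affine x)

  Q-off-diagonal : ∀ {x y} → x ≢ y → Q x y ≡ ∣ B ∣ * ∣ B ∣
  Q-off-diagonal {x} {y} x≢y = begin
    Q x y
      ≡⟨ ∑∑-cong (λ l μ → cong (λ z → 𝟙B (affine l μ x) * 𝟙B z) (φy≡ l μ)) ⟩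
    ∑[ l < p ] ∑[ μ < p ] (𝟙B ((l *ₚ x) +ₚ μ) * 𝟙B (((l *ₚ x) +ₚ μ) +ₚ (l *ₚ d)))
      ≡⟨ sum-cong-≗ (λ l → ∑-translate (l *ₚ x) (λ u → 𝟙B u * 𝟙B (u +ₚ (l *ₚ d)))) ⟩
    ∑[ l < p ] ∑[ u < p ] (𝟙B u * 𝟙B (u +ₚ (l *ₚ d)))
      ≡⟨ ∑-comm (λ l u → 𝟙B u * 𝟙B (u +ₚ (l *ₚ d))) ⟩
    ∑[ u < p ] ∑[ l < p ] (𝟙B u * 𝟙B (u +ₚ (l *ₚ d)))
      ≡⟨ sum-cong-≗ (λ u → *-distribˡ-sum (𝟙B u) (λ l → 𝟙B (u +ₚ (l *ₚ d)))) ⟨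
    ∑[ u < p ] (𝟙B u * ∑[ l < p ] 𝟙B (u +ₚ (l *ₚ d)))
      ≡⟨ sum-cong-≗ (λ u → cong (𝟙B u *_) (∑-line u)) ⟩
    ∑[ u < p ] (𝟙B u * ∣ B ∣)
      ≡⟨ *-distribʳ-sum ∣ B ∣ 𝟙B ⟨
    sum 𝟙B * ∣ B ∣
      ≡⟨ cong (_* ∣ B ∣) ∑𝟙B ⟩
    ∣ B ∣ * ∣ B ∣
      ∎
    where
    open ≡-Reasoning
    d = y −ₚ x
    φy≡ : ∀ l μ → affine l μ y ≡ affine l μ x +ₚ (l *ₚ d)
    φy≡ l μ = trans (cong (affine l μ) (sym (+ₚ-−ₚ x y))) (affine-+ₚ l μ x d)
    ∑-line : ∀ u → ∑[ l < p ] 𝟙B (u +ₚ (l *ₚ d)) ≡ ∣ B ∣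
    ∑-line u = trans (∑-dilate p-prime (−ₚ≢0 x≢y) (λ v → 𝟙B (u +ₚ v))) (trans (∑-translate u 𝟙B) ∑𝟙B)

  ∑-𝟙A*Q : ∀ x → ∑[ y < p ] (𝟙A y * Q x y) ≤ p * ∣ B ∣ + ∣ A ∣ * (∣ B ∣ * ∣ B ∣)
  ∑-𝟙A*Q x = begin
    ∑[ y < p ] (𝟙A y * Q x y)                 ≤⟨ ∑-remove-≤ x (λ y y≢x → ≤-reflexive (cong (𝟙A y *_) (Q-off-diagonal (y≢x ∘ sym)))) ⟩
    𝟙A x * Q x x + ∑[ y < p ] (𝟙A y * (∣ B ∣ * ∣ B ∣)) ≤⟨ +-monoˡ-≤ _ (𝟙*-≤ (lookup A x) (Q x x)) ⟩
    Q x x + ∑[ y < p ] (𝟙A y * (∣ B ∣ * ∣ B ∣)) ≡⟨ cong₂ _+_ (Q-diagonal x) (sym (*-distribʳ-sum (∣ B ∣ * ∣ B ∣) 𝟙A)) ⟩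
    p * ∣ B ∣ + sum 𝟙A * (∣ B ∣ * ∣ B ∣)        ≡⟨ cong (λ a → p * ∣ B ∣ + a * (∣ B ∣ * ∣ B ∣)) ∑𝟙A ⟩
    p * ∣ B ∣ + ∣ A ∣ * (∣ B ∣ * ∣ B ∣)         ∎
    where open ≤-Reasoning

  ∑∑∣C∣² : ∑[ l < p ] ∑[ μ < p ] (∣ C l μ ∣ * ∣ C l μ ∣) ≤ ∣ A ∣ * ∣ B ∣ * p + ∣ A ∣ * ∣ B ∣ * (∣ A ∣ * ∣ B ∣)
  ∑∑∣C∣² = begin
    ∑[ l < p ] ∑[ μ < p ] (∣ C l μ ∣ * ∣ C l μ ∣)
      ≡⟨ ∑∑-cong (λ l μ → trans (cong₂ _*_ (∣C∣≡ l μ) (∣C∣≡ l μ)) (sum-*-sum (c l μ) (c l μ))) ⟩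
    ∑[ l < p ] ∑[ μ < p ] ∑[ x < p ] ∑[ y < p ] (c l μ x * c l μ y)
      ≡⟨ ∑∑-comm-∑∑ (λ l μ x y → c l μ x * c l μ y) ⟩
    ∑[ x < p ] ∑[ y < p ] ∑[ l < p ] ∑[ μ < p ] (c l μ x * c l μ y)
      ≡⟨ ∑∑-cong (λ x y → trans (∑∑-cong (λ l μ → interchange-* (𝟙A x) (𝟙B (affine l μ x)) (𝟙A y) (𝟙B (affine l μ y))))
                                 (sym (*-distribˡ-∑∑ (𝟙A x * 𝟙A y) (λ l μ → 𝟙B (affine l μ x) * 𝟙B (affine l μ y))))) ⟩
    ∑[ x < p ] ∑[ y < p ] (𝟙A x * 𝟙A y * Q x y)
      ≡⟨ sum-cong-≗ (λ x → trans (sum-cong-≗ {p} (λ y → *-assoc (𝟙A x) (𝟙A y) (Q x y))) (sym (*-distribˡ-sum (𝟙A x) (λ y → 𝟙A y * Q x y)))) ⟩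
    ∑[ x < p ] (𝟙A x * ∑[ y < p ] (𝟙A y * Q x y))
      ≤⟨ ∑-mono-≤ (λ x → *-monoʳ-≤ (𝟙A x) (∑-𝟙A*Q x)) ⟩
    ∑[ x < p ] (𝟙A x * (p * ∣ B ∣ + ∣ A ∣ * (∣ B ∣ * ∣ B ∣)))
      ≡⟨ *-distribʳ-sum _ 𝟙A ⟨
    sum 𝟙A * (p * ∣ B ∣ + ∣ A ∣ * (∣ B ∣ * ∣ B ∣))
      ≡⟨ cong (_* (p * ∣ B ∣ + ∣ A ∣ * (∣ B ∣ * ∣ B ∣))) ∑𝟙A ⟩
    ∣ A ∣ * (p * ∣ B ∣ + ∣ A ∣ * (∣ B ∣ * ∣ B ∣))
      ≡⟨ expand ∣ A ∣ ∣ B ∣ p ⟩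
    ∣ A ∣ * ∣ B ∣ * p + ∣ A ∣ * ∣ B ∣ * (∣ A ∣ * ∣ B ∣)
      ∎
    where
    open ≤-Reasoning
    c : Fin p → Fin p → Fin p → ℕ
    c l μ x = 𝟙A x * 𝟙B (affine l μ x)
    ∣C∣≡ : ∀ l μ → ∣ C l μ ∣ ≡ sum (c l μ)
    ∣C∣≡ l μ = trans (∣X∣≡∑𝟙 (C l μ)) (sum-cong-≗ (𝟙-C l μ))
    interchange-* : ∀ a b a′ b′ → (a * b) * (a′ * b′) ≡ (a * a′) * (b * b′)
    interchange-* = solve 4 (λ a b a′ b′ → (a :* b) :* (a′ :* b′) := (a :* a′) :* (b :* b′)) refl
    expand : ∀ a b p → a * (p * b + a * (b * b)) ≡ a * b * p + a * b * (a * b)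
    expand = solve 3 (λ a b p → a :* (p :* b :+ a :* (b :* b)) := a :* b :* p :+ a :* b :* (a :* b)) refl

  ∑∑-AP-B≤ : ∀ n {m} → toℕ m ≢ 0 →
             ∑[ l < p ] ∑[ μ < p ] 𝟙 (AP B (affine l μ n) (l *ₚ m)) ≤ num3AP B + p
  ∑∑-AP-B≤ n {m} m≢0 = begin
    ∑[ l < p ] ∑[ μ < p ] 𝟙 (AP B ((l *ₚ n) +ₚ μ) (l *ₚ m))
      ≡⟨ sum-cong-≗ (λ l → ∑-translate (l *ₚ n) (λ u → 𝟙 (AP B u (l *ₚ m)))) ⟩
    ∑[ l < p ] ∑[ u < p ] 𝟙 (AP B u (l *ₚ m))
      ≡⟨ ∑-comm (λ l u → 𝟙 (AP B u (l *ₚ m))) ⟩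
    ∑[ u < p ] ∑[ l < p ] 𝟙 (AP B u (l *ₚ m))
      ≡⟨ sum-cong-≗ (λ u → ∑-dilate p-prime m≢0 (λ v → 𝟙 (AP B u v))) ⟩
    ∑[ u < p ] ∑[ v < p ] 𝟙 (AP B u v)
      ≤⟨ ∑∑-AP≤ B ⟩
    num3AP B + p
      ∎
    where open ≤-Reasoning

  ∑∑-num3AP-C : ∑[ l < p ] ∑[ μ < p ] num3AP (C l μ) ≤ num3AP A * (num3AP B + p)
  ∑∑-num3AP-C = begin
    ∑[ l < p ] ∑[ μ < p ] num3AP (C l μ)
      ≡⟨ ∑∑-cong (λ l μ → trans (num3AP≡∑∑ (C l μ)) (∑∑-cong (𝟙-is3AP-C l μ))) ⟩
    ∑[ l < p ] ∑[ μ < p ] ∑[ n < p ] ∑[ m < p ] F l μ n m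
      ≡⟨ ∑∑-comm-∑∑ F ⟩
    ∑[ n < p ] ∑[ m < p ] ∑[ l < p ] ∑[ μ < p ] F l μ n m
      ≡⟨ ∑∑-cong (λ n m → *-distribˡ-∑∑ (𝟙 (is3AP A n m)) (λ l μ → 𝟙 (AP B (affine l μ n) (l *ₚ m)))) ⟨
    ∑[ n < p ] ∑[ m < p ] (𝟙 (is3AP A n m) * ∑[ l < p ] ∑[ μ < p ] 𝟙 (AP B (affine l μ n) (l *ₚ m)))
      ≤⟨ ∑∑-mono-≤ (λ n m → 𝟙-*-mono-≤ (is3AP A n m) (λ is3AP≡true → ∑∑-AP-B≤ n (is3AP⇒≢0 A n m is3AP≡true))) ⟩
    ∑[ n < p ] ∑[ m < p ] (𝟙 (is3AP A n m) * (num3AP B + p))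
      ≡⟨ *-distribʳ-∑∑ (num3AP B + p) (λ n m → 𝟙 (is3AP A n m)) ⟨
    (∑[ n < p ] ∑[ m < p ] 𝟙 (is3AP A n m)) * (num3AP B + p)
      ≡⟨ cong (_* (num3AP B + p)) (num3AP≡∑∑ A) ⟨
    num3AP A * (num3AP B + p)
      ∎
    where
    open ≤-Reasoning
    F : Fin p → Fin p → Fin p → Fin p → ℕ
    F l μ n m = 𝟙 (is3AP A n m) * 𝟙 (AP B (affine l μ n) (l *ₚ m))

  ∣A∣*∣B∣≤p² : ∣ A ∣ * ∣ B ∣ ≤ p ^ 2
  ∣A∣*∣B∣≤p² = ≤-trans (*-mono-≤ (∣p∣≤n A) (∣p∣≤n B)) (≤-reflexive (cong (p *_) (sym (*-identityʳ p))))

  D : Fin p → Fin p → ℕ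
  D l μ = ∣ A ∣ * ∣ B ∣ ∸ ∣ C l μ ∣ * p

  ∑∑-D² : ∑[ l < p ] ∑[ μ < p ] (D l μ ^ 2) ≤ ∣ A ∣ * ∣ B ∣ * p ^ 3
  ∑∑-D² = +-cancelʳ-≤ (2 * c * (c * p * p)) _ _ (begin
    ∑∑D² + 2 * c * (c * p * p)
      ≡⟨ cong (λ s → ∑∑D² + 2 * c * s) ∑∑∣C∣p ⟨
    ∑∑D² + 2 * c * (∑[ l < p ] ∑[ μ < p ] (∣ C l μ ∣ * p))
      ≤⟨ ∑∑-[c∸X]²-≤ c (λ l μ → ∣ C l μ ∣ * p) ⟩
    p * (p * c ^ 2) + ∑[ l < p ] ∑[ μ < p ] ((∣ C l μ ∣ * p) ^ 2)
      ≡⟨ cong (p * (p * c ^ 2) +_) ∑∑[∣C∣p]² ⟩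
    p * (p * c ^ 2) + (∑[ l < p ] ∑[ μ < p ] (∣ C l μ ∣ * ∣ C l μ ∣)) * p ^ 2
      ≤⟨ +-monoʳ-≤ (p * (p * c ^ 2)) (*-monoˡ-≤ (p ^ 2) ∑∑∣C∣²) ⟩
    p * (p * c ^ 2) + (c * p + c * c) * p ^ 2
      ≡⟨ collect c p ⟩
    c * p ^ 3 + 2 * c * (c * p * p)
      ∎)
    where
    open ≤-Reasoning
    c = ∣ A ∣ * ∣ B ∣
    ∑∑D² = ∑[ l < p ] ∑[ μ < p ] (D l μ ^ 2)
    ∑∑∣C∣p : (∑[ l < p ] ∑[ μ < p ] (∣ C l μ ∣ * p)) ≡ c * p * p
    ∑∑∣C∣p = trans (sym (*-distribʳ-∑∑ p (λ l μ → ∣ C l μ ∣))) (cong (_* p) ∑∑∣C∣)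
    square-* : ∀ x p → (x * p) ^ 2 ≡ x * x * p ^ 2
    square-* = solve 2 (λ x p → (x :* p) :^ 2 := x :* x :* p :^ 2) refl
    ∑∑[∣C∣p]² : (∑[ l < p ] ∑[ μ < p ] ((∣ C l μ ∣ * p) ^ 2)) ≡ (∑[ l < p ] ∑[ μ < p ] (∣ C l μ ∣ * ∣ C l μ ∣)) * p ^ 2
    ∑∑[∣C∣p]² = trans (∑∑-cong (λ l μ → square-* ∣ C l μ ∣ p)) (sym (*-distribʳ-∑∑ (p ^ 2) (λ l μ → ∣ C l μ ∣ * ∣ C l μ ∣)))
    collect : ∀ c p → p * (p * c ^ 2) + (c * p + c * c) * p ^ 2 ≡ c * p ^ 3 + 2 * c * (c * p * p)
    collect = solve 2 (λ c p → p :* (p :* c :^ 2) :+ (c :* p :+ c :* c) :* p :^ 2 := c :* p :^ 3 :+ con 2 :* c :* (c :* p :* p)) refl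

  Φ : ℕ → Fin p → Fin p → ℕ
  Φ r l μ = r * num3AP (C l μ) + D l μ ^ 2

  ∃-good-slice : ∀ r → ∃[ l ] ∃[ μ ] (p ^ 2 * (r * num3AP (C l μ) + D l μ ^ 2)
                                        ≤ r * (num3AP A * (num3AP B + p)) + ∣ A ∣ * ∣ B ∣ * p ^ 3)
  ∃-good-slice r with ∃∃-≤-average (Φ r)
  ... | l , μ , avg = l , μ , (begin
    p ^ 2 * Φ r l μ                                                           ≡⟨ *-assoc p (p * 1) (Φ r l μ) ⟩
    p * (p * 1 * Φ r l μ)                                                     ≡⟨ cong (λ q → p * (q * Φ r l μ)) (*-identityʳ p) ⟩
    p * (p * Φ r l μ)                                                         ≤⟨ avg ⟩
    ∑[ l < p ] ∑[ μ < p ] Φ r l μ                                             ≡⟨ ∑∑-distrib-+ (λ l μ → r * num3AP (C l μ)) (λ l μ → D l μ ^ 2) ⟩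
    (∑[ l < p ] ∑[ μ < p ] (r * num3AP (C l μ))) + (∑[ l < p ] ∑[ μ < p ] (D l μ ^ 2))
      ≡⟨ cong (_+ (∑[ l < p ] ∑[ μ < p ] (D l μ ^ 2))) (*-distribˡ-∑∑ r (λ l μ → num3AP (C l μ))) ⟨
    r * (∑[ l < p ] ∑[ μ < p ] num3AP (C l μ)) + (∑[ l < p ] ∑[ μ < p ] (D l μ ^ 2))
      ≤⟨ +-mono-≤ (*-monoʳ-≤ r ∑∑-num3AP-C) ∑∑-D² ⟩
    r * (num3AP A * (num3AP B + p)) + ∣ A ∣ * ∣ B ∣ * p ^ 3                 ∎)
    where open ≤-Reasoning

deviation-bound : ∀ {p r c NA NB Y D} .{{_ : NonZero p}} →
                  r ^ 2 ≤ p ^ 3 → c ≤ p ^ 2 → NA ≤ p ^ 2 → NB ≤ p ^ 2 →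
                  p ^ 2 * (r * Y + D ^ 2) ≤ r * (NA * (NB + p)) + c * p ^ 3 →
                  D ^ 4 ≤ 10 * p ^ 7
deviation-bound {p} {r} {c} {NA} {NB} {Y} {D} r²≤p³ c≤p² NA≤p² NB≤p² avg = begin
  D ^ 4                                    ≡⟨ ^-*-assoc D 2 2 ⟨
  (D ^ 2) ^ 2                              ≤⟨ ^-monoˡ-≤ 2 D²≤ ⟩
  (2 * r * p ^ 2 + p ^ 3) ^ 2              ≤⟨ [m+n]²≤2[m²+n²] (2 * r * p ^ 2) (p ^ 3) ⟩
  2 * ((2 * r * p ^ 2) ^ 2 + (p ^ 3) ^ 2)  ≡⟨ expand r p ⟩
  2 * (4 * (r ^ 2 * p ^ 4) + p ^ 6 * 1)    ≤⟨ *-monoʳ-≤ 2 (+-mono-≤ (*-monoʳ-≤ 4 (*-monoˡ-≤ (p ^ 4) r²≤p³))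
                                                                   (*-monoʳ-≤ (p ^ 6) (>-nonZero⁻¹ p))) ⟩
  2 * (4 * (p ^ 3 * p ^ 4) + p ^ 6 * p)    ≡⟨ collect p ⟩
  10 * p ^ 7                               ∎
  where
  open ≤-Reasoning
  instance
    p²≢0 : NonZero (p ^ 2)
    p²≢0 = m^n≢0 p 2
  p≤p² : p ≤ p ^ 2
  p≤p² = m≤m*n p (p ^ 1) {{m^n≢0 p 1}}
  R≤ : r * (NA * (NB + p)) + c * p ^ 3 ≤ p ^ 2 * (2 * r * p ^ 2 + p ^ 3)
  R≤ = begin
    r * (NA * (NB + p)) + c * p ^ 3
      ≤⟨ +-mono-≤ (*-monoʳ-≤ r (*-mono-≤ NA≤p² (+-mono-≤ NB≤p² p≤p²))) (*-monoˡ-≤ (p ^ 3) c≤p²) ⟩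
    r * (p ^ 2 * (p ^ 2 + p ^ 2)) + p ^ 2 * p ^ 3
      ≡⟨ factor r p ⟩
    p ^ 2 * (2 * r * p ^ 2 + p ^ 3)
      ∎
    where
    factor : ∀ r p → r * (p ^ 2 * (p ^ 2 + p ^ 2)) + p ^ 2 * p ^ 3 ≡ p ^ 2 * (2 * r * p ^ 2 + p ^ 3)
    factor = solve 2 (λ r p → r :* (p :^ 2 :* (p :^ 2 :+ p :^ 2)) :+ p :^ 2 :* p :^ 3
                           := p :^ 2 :* (con 2 :* r :* p :^ 2 :+ p :^ 3)) refl
  D²≤ : D ^ 2 ≤ 2 * r * p ^ 2 + p ^ 3
  D²≤ = *-cancelˡ-≤ (p ^ 2) (≤-trans (*-monoʳ-≤ (p ^ 2) (m≤n+m (D ^ 2) (r * Y))) (≤-trans avg R≤))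
  expand : ∀ r p → 2 * ((2 * r * p ^ 2) ^ 2 + (p ^ 3) ^ 2) ≡ 2 * (4 * (r ^ 2 * p ^ 4) + p ^ 6 * 1)
  expand = solve 2 (λ r p → con 2 :* ((con 2 :* r :* p :^ 2) :^ 2 :+ (p :^ 3) :^ 2)
                         := con 2 :* (con 4 :* (r :^ 2 :* p :^ 4) :+ p :^ 6 :* con 1)) refl
  collect : ∀ p → 2 * (4 * (p ^ 3 * p ^ 4) + p ^ 6 * p) ≡ 10 * p ^ 7
  collect = solve 1 (λ p → con 2 :* (con 4 :* (p :^ 3 :* p :^ 4) :+ p :^ 6 :* p) := con 10 :* p :^ 7) refl

excess-bound : ∀ {p r c NA NB Y D} .{{_ : NonZero p}} →
               p ^ 3 ≤ 4 * r ^ 2 → c ≤ p ^ 2 → NA ≤ p ^ 2 →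
               p ^ 2 * (r * Y + D ^ 2) ≤ r * (NA * (NB + p)) + c * p ^ 3 →
               (Y * p ^ 2 ∸ NA * NB) ^ 2 ≤ 10 * p ^ 7
excess-bound {p} {zero} p³≤0 _ _ _ = contradiction p³≤0 (<⇒≱ (m^n>0 p 3))
excess-bound {p} {r@(suc _)} {c} {NA} {NB} {Y} {D} p³≤4r² c≤p² NA≤p² avg =
  *-cancelˡ-≤ (r ^ 2) {{m^n≢0 r 2}} (begin
    r ^ 2 * E ^ 2                                 ≡⟨ square-* r E ⟩
    (r * E) ^ 2                                   ≤⟨ ^-monoˡ-≤ 2 rE≤ ⟩
    (r * p ^ 3 + p ^ 5) ^ 2                       ≤⟨ [m+n]²≤2[m²+n²] (r * p ^ 3) (p ^ 5) ⟩
    2 * ((r * p ^ 3) ^ 2 + (p ^ 5) ^ 2)           ≡⟨ expand r p ⟩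
    2 * (r ^ 2 * (p ^ 6 * 1) + p ^ 3 * p ^ 7)     ≤⟨ *-monoʳ-≤ 2 (+-mono-≤ (*-monoʳ-≤ (r ^ 2) (*-monoʳ-≤ (p ^ 6) (>-nonZero⁻¹ p)))
                                                                        (*-monoˡ-≤ (p ^ 7) p³≤4r²)) ⟩
    2 * (r ^ 2 * (p ^ 6 * p) + 4 * r ^ 2 * p ^ 7) ≡⟨ collect r p ⟩
    r ^ 2 * (10 * p ^ 7)                          ∎)
  where
  open ≤-Reasoning
  E = Y * p ^ 2 ∸ NA * NB
  rYp²≤ : r * (Y * p ^ 2) ≤ r * (NA * NB) + (r * (NA * p) + c * p ^ 3)
  rYp²≤ = begin
    r * (Y * p ^ 2)                         ≡⟨ rearrange r Y p ⟩
    p ^ 2 * (r * Y)                         ≤⟨ *-monoʳ-≤ (p ^ 2) (m≤m+n (r * Y) (D ^ 2)) ⟩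
    p ^ 2 * (r * Y + D ^ 2)                 ≤⟨ avg ⟩
    r * (NA * (NB + p)) + c * p ^ 3         ≡⟨ distribute r NA NB p (c * p ^ 3) ⟩
    r * (NA * NB) + (r * (NA * p) + c * p ^ 3) ∎
    where
    rearrange : ∀ r y p → r * (y * p ^ 2) ≡ p ^ 2 * (r * y)
    rearrange = solve 3 (λ r y p → r :* (y :* p :^ 2) := p :^ 2 :* (r :* y)) refl
    distribute : ∀ r a b p q → r * (a * (b + p)) + q ≡ r * (a * b) + (r * (a * p) + q)
    distribute = solve 5 (λ r a b p q → r :* (a :* (b :+ p)) :+ q := r :* (a :* b) :+ (r :* (a :* p) :+ q)) refl
  rE≤ : r * E ≤ r * p ^ 3 + p ^ 5
  rE≤ = begin
    r * E                             ≡⟨ *-distribˡ-∸ r (Y * p ^ 2) (NA * NB) ⟩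
    r * (Y * p ^ 2) ∸ r * (NA * NB)   ≤⟨ m≤n+o⇒m∸n≤o (r * (Y * p ^ 2)) (r * (NA * NB)) rYp²≤ ⟩
    r * (NA * p) + c * p ^ 3          ≤⟨ +-mono-≤ (*-monoʳ-≤ r (*-monoˡ-≤ p NA≤p²)) (*-monoˡ-≤ (p ^ 3) c≤p²) ⟩
    r * (p ^ 2 * p) + p ^ 2 * p ^ 3   ≡⟨ collect-powers r p ⟩
    r * p ^ 3 + p ^ 5                 ∎
    where
    collect-powers : ∀ r p → r * (p ^ 2 * p) + p ^ 2 * p ^ 3 ≡ r * p ^ 3 + p ^ 5
    collect-powers = solve 2 (λ r p → r :* (p :^ 2 :* p) :+ p :^ 2 :* p :^ 3 := r :* p :^ 3 :+ p :^ 5) refl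
  square-* : ∀ r e → r ^ 2 * e ^ 2 ≡ (r * e) ^ 2
  square-* = solve 2 (λ r e → r :^ 2 :* e :^ 2 := (r :* e) :^ 2) refl
  expand : ∀ r p → 2 * ((r * p ^ 3) ^ 2 + (p ^ 5) ^ 2) ≡ 2 * (r ^ 2 * (p ^ 6 * 1) + p ^ 3 * p ^ 7)
  expand = solve 2 (λ r p → con 2 :* ((r :* p :^ 3) :^ 2 :+ (p :^ 5) :^ 2)
                         := con 2 :* (r :^ 2 :* (p :^ 6 :* con 1) :+ p :^ 3 :* p :^ 7)) refl
  collect : ∀ r p → 2 * (r ^ 2 * (p ^ 6 * p) + 4 * r ^ 2 * p ^ 7) ≡ r ^ 2 * (10 * p ^ 7)
  collect = solve 2 (λ r p → con 2 :* (r :^ 2 :* (p :^ 6 :* p) :+ con 4 :* r :^ 2 :* p :^ 7)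
                          := r :^ 2 :* (con 10 :* p :^ 7)) refl

lemma4 : (m : ℕ) → ∃[ K ] ((p : ℕ) .{{_ : NonZero p}} → Prime p → (A B : Subset p) →
           ∣ A ∣ * m ≥ p → ∣ B ∣ * m ≥ p →
           ∃[ C ] (((∣ A ∣ * ∣ B ∣ ∸ ∣ C ∣ * p) ^ 4 ≤ K * p ^ 7)
                  × ((num3AP C * p ^ 2 ∸ num3AP A * num3AP B) ^ 2 ≤ K * p ^ 7)))
lemma4 _ = 10 , λ p p-prime A B _ _ →
  let open AffineIntersection p-prime A B
      (r , r²≤p³ , p³≤4r²) = coarse-sqrt (p ^ 3) {{m^n≢0 p 3}}
      (l , μ , avg) = ∃-good-slice r
  in C l μ , deviation-bound {r = r} {D = D l μ} r²≤p³ ∣A∣*∣B∣≤p² (num3AP≤p² A) (num3AP≤p² B) avg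
           , excess-bound {r = r} {D = D l μ} p³≤4r² ∣A∣*∣B∣≤p² (num3AP≤p² A) avg
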